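{- For $k\geq 1$ and $n\geq 0$, \[g_k(n)=\sum_{i=0}^{\lfloor n/k\rfloor}(i+1)\,g_{k-1}(n-ki),\] and for $k\geq 2$ and $n\geq 0$, \[h_k(n)=\sum_{i=0}^{\lfloor n/k\rfloor-2}(i+1)\,h_{k-1}(n-ki-2).\]
   Context: For $k\geq 0$, $g_k(n)$ is the number of pairs $(\alpha,\beta)$ of partitions, each with at most $k$ parts, with $|\alpha|+|\beta|=n$; so $\sum_{n\geq0}g_k(n)q^n=1/(q;q)_k^2$ (with $g_0(0)=1$, $g_0(n)=0$ for $n\geq1$, and $g_k(n)=0$ for $n<0$). For $k\geq 2$, $h_k(n)$ is the number of pairs $(\alpha,\beta)$ of partitions, each with exactly $k$ parts, with $|\alpha|+|\beta|=n$ and such that the largest part of $\beta$ appears at least twice; $h_1(n)=1$ for $n\geq2$ and $h_1(0)=h_1(1)=0$; $h_k(n)=0$ for $n<0$. Thus for $k\geq 1$, $\sum_{n\geq0}h_k(n)q^n=\frac{q^{2k}}{(q;q)_k(q^2;q)_{k-1}}$, where $(a;q)_j=\prod_{i=0}^{j-1}(1-aq^i)$. An empty sum is $0$. -}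

module Defs where

open import Data.Nat using (ℕ; zero; suc; _+_; _*_; _∸_; _≤ᵇ_; _≡ᵇ_)
open import Data.Bool using (Bool; true; false; _∧_)
open import Data.List using (List; []; _∷_; [_]; map; concatMap; upTo; length; filterᵇ; cartesianProduct)
open import Data.Nat.ListAction using (sum)
open import Data.Vec using (Vec; []; _∷_)
open import Data.Product using (_×_; _,_)

Σ< : ℕ → (ℕ → ℕ) → ℕ
Σ< m f = sum (map f (upTo m))

allVecs : (k N : ℕ) → List (Vec ℕ k)
allVecs zero    N = [ [] ]
allVecs (suc k) N = concatMap (λ x → map (x ∷_) (allVecs k N)) (upTo (suc N))

vsum : {k : ℕ} → Vec ℕ k → ℕ
vsum []       = 0
vsum (x ∷ xs) = x + vsum xs

nonincᵇ : {k : ℕ} → Vec ℕ k → Bool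
nonincᵇ []           = true
nonincᵇ (x ∷ [])     = true
nonincᵇ (x ∷ y ∷ xs) = (y ≤ᵇ x) ∧ nonincᵇ (y ∷ xs)

posᵇ : {k : ℕ} → Vec ℕ k → Bool
posᵇ []       = true
posᵇ (x ∷ xs) = (1 ≤ᵇ x) ∧ posᵇ xs

-- A partition with at most k parts is encoded as a non-increasing k-vector of
-- naturals (padding with zeros); with exactly k parts: additionally all
-- entries positive.  Parts of a partition of size ≤ N are ≤ N, so the
-- enumeration allVecs k N is exhaustive.

atMostᵇ : {k : ℕ} → Vec ℕ k → Bool
atMostᵇ = nonincᵇ

exactlyᵇ : {k : ℕ} → Vec ℕ k → Bool
exactlyᵇ v = nonincᵇ v ∧ posᵇ v

-- Largest part appears at least twice (for k ≥ 2 exactly-k-part partitions,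
-- this means the first two entries coincide).
topTwiceᵇ : {k : ℕ} → Vec ℕ (suc (suc k)) → Bool
topTwiceᵇ (x ∷ y ∷ _) = x ≡ᵇ y

g : ℕ → ℕ → ℕ
g k n = length (filterᵇ ok (cartesianProduct (allVecs k n) (allVecs k n)))
  where
  ok : Vec ℕ k × Vec ℕ k → Bool
  ok (a , b) = atMostᵇ a ∧ atMostᵇ b ∧ (vsum a + vsum b ≡ᵇ n)

-- h k n : for k ≥ 2, number of pairs (α , β) of partitions with exactly k
-- parts each, |α| + |β| = n, largest part of β appearing at least twice;
-- h 1 n = 1 for n ≥ 2, h 1 0 = h 1 1 = 0.  (h 0 is unused; set to 0.)
h : ℕ → ℕ → ℕ
h zero          n = 0
h (suc zero)    n = if2 n
  where
  if2 : ℕ → ℕ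
  if2 (suc (suc _)) = 1
  if2 _             = 0
h (suc (suc k)) n =
  length (filterᵇ ok (cartesianProduct (allVecs (suc (suc k)) n) (allVecs (suc (suc k)) n)))
  where
  ok : Vec ℕ (suc (suc k)) × Vec ℕ (suc (suc k)) → Bool
  ok (a , b) = exactlyᵇ a ∧ exactlyᵇ b ∧ topTwiceᵇ b ∧ (vsum a + vsum b ≡ᵇ n)

-- In generating-function terms g_k = P_k², where P_k = 1 / (q; q)_k counts partitions
-- with at most k parts, and h_{k+1} = q^(2k+2) U_k with U_k = 1 / ((q; q)_{k+1} (q²; q)_k).
-- Passing from k to k + 1 multiplies P_k² (resp. U_k) by 1 / (1 − q^K)², with K = k + 1
-- (resp. k + 2), and 1 / (1 − q^K)² = Σᵢ (i + 1) q^(K i) gives the two recurrences.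
-- Series are functions ℕ → ℕ under convolution; division by 1 − q^K is characterised as the
-- unique solution of u = f + q^K u, which makes it commute with convolution.  The product
-- formulas for the counts come from recurrences of the same shape for partition numbers,
-- obtained by removing the largest part or subtracting one from every part.

module Submission where

open import Defs
open import Data.Nat
  using (ℕ; zero; suc; _+_; _*_; _∸_; _/_; _≤_; _<_; _≤ᵇ_; _<ᵇ_; _≡ᵇ_; z≤n; s≤s; s≤s⁻¹; _≤?_)
open import Data.Nat.Properties
open import Data.Nat.Induction using (<-rec)
open import Data.Nat.DivMod using (m*n/n≡m; /-monoˡ-≤; m/n*n≤m; m/n≤m; m/n≡1+[m∸n]/n; m<n*o⇒m/o<n)
open import Data.Nat.Tactic.RingSolver using (solve-∀)
open import Data.Bool using (Bool; true; false; _∧_; T)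
open import Data.Bool.Properties using (∧-assoc; ∧-zeroʳ; ∧-identityʳ; ∧-idempotentCommutativeMonoid)
open import Data.Unit using (tt)
open import Data.List
  using (List; []; _∷_; map; concatMap; upTo; applyUpTo; length; filterᵇ; cartesianProduct; _++_)
open import Data.List.Properties using (map-++; map-∘)
open import Data.Nat.ListAction using (sum)
open import Data.Nat.ListAction.Properties using (sum-++)
open import Data.Vec using (Vec; []; _∷_)
open import Data.Product using (_×_; _,_)
open import Function using (_∘_; id)
open import Relation.Nullary using (yes; no; contradiction)
open import Relation.Binary.PropositionalEquality
open ≡-Reasoning
import Algebra.Solver.IdempotentCommutativeMonoid as ∧-Solver
open ∧-Solver ∧-idempotentCommutativeMonoid using (solve; _⊜_; _⊕_)

-- Indicators and finite sums

𝟙 : Bool → ℕ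
𝟙 true  = 1
𝟙 false = 0

𝟙-∧ : ∀ a b → 𝟙 (a ∧ b) ≡ 𝟙 a * 𝟙 b
𝟙-∧ true  b = sym (+-identityʳ (𝟙 b))
𝟙-∧ false b = refl

𝟙-∧-* : ∀ a b x → 𝟙 a * (𝟙 b * x) ≡ 𝟙 (a ∧ b) * x
𝟙-∧-* true  b x = *-identityˡ (𝟙 b * x)
𝟙-∧-* false b x = refl

≤ᵇ-true : ∀ {m n} → m ≤ n → (m ≤ᵇ n) ≡ true
≤ᵇ-true {m} {n} m≤n with m ≤ᵇ n | ≤⇒≤ᵇ m≤n
... | true | _ = refl

≤ᵇ-false : ∀ {m n} → n < m → (m ≤ᵇ n) ≡ false
≤ᵇ-false {m} {n} n<m with m ≤ᵇ n in eq
... | false = refl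
... | true  = contradiction (≤ᵇ⇒≤ m n (subst T (sym eq) tt)) (<⇒≱ n<m)

𝟙≤ᵇ-*-≤ : ∀ {m n} x → m ≤ n → 𝟙 (m ≤ᵇ n) * x ≡ x
𝟙≤ᵇ-*-≤ x m≤n rewrite ≤ᵇ-true m≤n = *-identityˡ x

𝟙≤ᵇ-*-> : ∀ {m n} x → n < m → 𝟙 (m ≤ᵇ n) * x ≡ 0
𝟙≤ᵇ-*-> x n<m rewrite ≤ᵇ-false n<m = refl

suc-≤ᵇ-suc : ∀ m n → (suc m ≤ᵇ suc n) ≡ (m ≤ᵇ n)
suc-≤ᵇ-suc zero    n = refl
suc-≤ᵇ-suc (suc m) n = refl

≤ᵇ-∸ : ∀ a b t → ((b ≤ᵇ t) ∧ (a ≤ᵇ t ∸ b)) ≡ (b + a ≤ᵇ t)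
≤ᵇ-∸ a zero    t       = refl
≤ᵇ-∸ a (suc b) zero    = refl
≤ᵇ-∸ a (suc b) (suc t) =
  trans (cong (_∧ (a ≤ᵇ t ∸ b)) (suc-≤ᵇ-suc b t)) (trans (≤ᵇ-∸ a b t) (sym (suc-≤ᵇ-suc (b + a) t)))

+-≡ᵇ : ∀ x s t → (x + s ≡ᵇ t) ≡ ((x ≤ᵇ t) ∧ (s ≡ᵇ t ∸ x))
+-≡ᵇ zero    s t       = refl
+-≡ᵇ (suc x) s zero    = refl
+-≡ᵇ (suc x) s (suc t) = trans (+-≡ᵇ x s t) (cong (_∧ (s ≡ᵇ t ∸ x)) (sym (suc-≤ᵇ-suc x t)))

𝟙≤ᵇ-*-𝟙≤ᵇ : ∀ a b t x → 𝟙 (b ≤ᵇ t) * (𝟙 (a ≤ᵇ t ∸ b) * x) ≡ 𝟙 (b + a ≤ᵇ t) * x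
𝟙≤ᵇ-*-𝟙≤ᵇ a b t x =
  trans (𝟙-∧-* (b ≤ᵇ t) (a ≤ᵇ t ∸ b) x) (cong (λ c → 𝟙 c * x) (≤ᵇ-∸ a b t))

∑ : ℕ → (ℕ → ℕ) → ℕ
∑ zero    f = 0
∑ (suc m) f = f 0 + ∑ m (f ∘ suc)

Σ<≡∑ : ∀ m f → Σ< m f ≡ ∑ m f
Σ<≡∑ m f = go id m
  where
  go : ∀ (e : ℕ → ℕ) m → sum (map f (applyUpTo e m)) ≡ ∑ m (f ∘ e)
  go e zero    = refl
  go e (suc m) = cong (f (e 0) +_) (go (e ∘ suc) m)

∑-cong : ∀ m {f g} → (∀ i → i < m → f i ≡ g i) → ∑ m f ≡ ∑ m g
∑-cong zero    eq = refl
∑-cong (suc m) eq = cong₂ _+_ (eq 0 (s≤s z≤n)) (∑-cong m (λ i i<m → eq (suc i) (s≤s i<m)))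

∑-cong′ : ∀ m {f g} → f ≗ g → ∑ m f ≡ ∑ m g
∑-cong′ m eq = ∑-cong m (λ i _ → eq i)

∑-zero : ∀ m {f} → (∀ i → i < m → f i ≡ 0) → ∑ m f ≡ 0
∑-zero zero    eq = refl
∑-zero (suc m) eq = cong₂ _+_ (eq 0 (s≤s z≤n)) (∑-zero m (λ i i<m → eq (suc i) (s≤s i<m)))

∑-+ : ∀ m f g → ∑ m (λ i → f i + g i) ≡ ∑ m f + ∑ m g
∑-+ zero    f g = refl
∑-+ (suc m) f g = trans (cong (f 0 + g 0 +_) (∑-+ m (f ∘ suc) (g ∘ suc)))
                        (+-+-interchange (f 0) (g 0) _ _)
  where
  +-+-interchange : ∀ a b c d → a + b + (c + d) ≡ a + c + (b + d)
  +-+-interchange = solve-∀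

∑-*ˡ : ∀ m c f → ∑ m (λ i → c * f i) ≡ c * ∑ m f
∑-*ˡ zero    c f = sym (*-zeroʳ c)
∑-*ˡ (suc m) c f = trans (cong (c * f 0 +_) (∑-*ˡ m c (f ∘ suc))) (sym (*-distribˡ-+ c (f 0) _))

∑-split : ∀ a b f → ∑ (a + b) f ≡ ∑ a f + ∑ b (λ i → f (a + i))
∑-split zero    b f = refl
∑-split (suc a) b f = trans (cong (f 0 +_) (∑-split a b (f ∘ suc))) (sym (+-assoc (f 0) _ _))

∑-last : ∀ m f → ∑ (suc m) f ≡ ∑ m f + f m
∑-last m f = begin
  ∑ (suc m) f                ≡⟨ cong (λ l → ∑ l f) (+-comm 1 m) ⟩
  ∑ (m + 1) f                ≡⟨ ∑-split m 1 f ⟩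
  ∑ m f + (f (m + 0) + 0)    ≡⟨ cong (∑ m f +_) (trans (+-identityʳ _) (cong f (+-identityʳ m))) ⟩
  ∑ m f + f m                ∎

∑-truncate : ∀ b m {f} → b ≤ m → (∀ i → b ≤ i → i < m → f i ≡ 0) → ∑ m f ≡ ∑ b f
∑-truncate b m {f} b≤m vanish = begin
  ∑ m f                                    ≡⟨ cong (λ l → ∑ l f) (sym (m+[n∸m]≡n b≤m)) ⟩
  ∑ (b + (m ∸ b)) f                        ≡⟨ ∑-split b (m ∸ b) f ⟩
  ∑ b f + ∑ (m ∸ b) (λ i → f (b + i))      ≡⟨ cong (∑ b f +_) (∑-zero (m ∸ b) tail) ⟩
  ∑ b f + 0                                ≡⟨ +-identityʳ _ ⟩
  ∑ b f                                    ∎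
  where
  tail : ∀ i → i < m ∸ b → f (b + i) ≡ 0
  tail i i<m∸b = vanish (b + i) (m≤m+n b i) (subst (b + i <_) (m+[n∸m]≡n b≤m) (+-monoʳ-< b i<m∸b))

∑-comm : ∀ m n (f : ℕ → ℕ → ℕ) → ∑ m (λ i → ∑ n (f i)) ≡ ∑ n (λ j → ∑ m (λ i → f i j))
∑-comm zero    n f = sym (∑-zero n (λ _ _ → refl))
∑-comm (suc m) n f = trans (cong (∑ n (f 0) +_) (∑-comm m n (f ∘ suc))) (sym (∑-+ n (f 0) _))

∑-select : ∀ m x (f : ℕ → ℕ) → ∑ m (λ i → 𝟙 (x ≡ᵇ i) * f i) ≡ 𝟙 (x <ᵇ m) * f x
∑-select zero    x       f = refl
∑-select (suc m) zero    f =
  trans (cong (f 0 + 0 +_) (∑-zero m {λ i → 𝟙 (0 ≡ᵇ suc i) * f (suc i)} (λ _ _ → refl))) (+-identityʳ _)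
∑-select (suc m) (suc x) f = ∑-select m x (f ∘ suc)

∑-gate : ∀ M N f → M ≤ N → ∑ (suc N) (λ x → 𝟙 (x ≤ᵇ M) * f x) ≡ ∑ (suc M) f
∑-gate M N f M≤N = begin
  ∑ (suc N) (λ x → 𝟙 (x ≤ᵇ M) * f x)
    ≡⟨ ∑-truncate (suc M) (suc N) (s≤s M≤N) (λ x M<x _ → 𝟙≤ᵇ-*-> (f x) M<x) ⟩
  ∑ (suc M) (λ x → 𝟙 (x ≤ᵇ M) * f x)
    ≡⟨ ∑-cong (suc M) (λ x x≤M → 𝟙≤ᵇ-*-≤ (f x) (s≤s⁻¹ x≤M)) ⟩
  ∑ (suc M) f ∎

∑-reverse : ∀ n f → ∑ (suc n) f ≡ ∑ (suc n) (λ a → f (n ∸ a))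
∑-reverse zero    f = refl
∑-reverse (suc n) f = begin
  f 0 + ∑ (suc n) (f ∘ suc)
    ≡⟨ cong (f 0 +_) (∑-reverse n (f ∘ suc)) ⟩
  f 0 + ∑ (suc n) (λ a → f (suc (n ∸ a)))
    ≡⟨ +-comm (f 0) _ ⟩
  ∑ (suc n) (λ a → f (suc (n ∸ a))) + f 0
    ≡⟨ cong₂ _+_ (∑-cong (suc n) (λ a a≤n → cong f (sym (+-∸-assoc 1 (s≤s⁻¹ a≤n)))))
                 (cong f (sym (n∸n≡0 (suc n)))) ⟩
  ∑ (suc n) (λ a → f (suc n ∸ a)) + f (suc n ∸ suc n)
    ≡⟨ sym (∑-last (suc n) (λ a → f (suc n ∸ a))) ⟩
  ∑ (suc (suc n)) (λ a → f (suc n ∸ a)) ∎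

-- Power series

Series : Set
Series = ℕ → ℕ

δ : Series
δ n = 𝟙 (0 ≡ᵇ n)

_⊛_ : Series → Series → Series
(f ⊛ g) n = ∑ (suc n) (λ a → f a * g (n ∸ a))

-- shift K f and geom K f are the series q^K f and f / (1 − q^K);
-- weightedGeom K ψ is Σᵢ q^(K i) ψᵢ.
shift : ℕ → Series → Series
shift K f n = 𝟙 (K ≤ᵇ n) * f (n ∸ K)

weightedGeom : ℕ → (ℕ → Series) → Series
weightedGeom K ψ n = ∑ (suc n) (λ i → 𝟙 (K * i ≤ᵇ n) * ψ i (n ∸ K * i))

geom : ℕ → Series → Series
geom K f = weightedGeom K (λ _ → f)

shift-≤ : ∀ {K n} f → K ≤ n → shift K f n ≡ f (n ∸ K)
shift-≤ f K≤n = 𝟙≤ᵇ-*-≤ _ K≤n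

shift-> : ∀ {K n} f → n < K → shift K f n ≡ 0
shift-> f n<K = 𝟙≤ᵇ-*-> _ n<K

shift-cong : ∀ K {f g} → f ≗ g → shift K f ≗ shift K g
shift-cong K eq n = cong (𝟙 (K ≤ᵇ n) *_) (eq (n ∸ K))

shift-cong-< : ∀ k {f g} n → (∀ m → m < n → f m ≡ g m) → shift (suc k) f n ≡ shift (suc k) g n
shift-cong-< k zero    eq = refl
shift-cong-< k (suc n) eq = cong (𝟙 (suc k ≤ᵇ suc n) *_) (eq (n ∸ k) (s≤s (m∸n≤m n k)))

shift-shift : ∀ K L f → shift K (shift L f) ≗ shift (K + L) f
shift-shift K L f n = begin
  𝟙 (K ≤ᵇ n) * (𝟙 (L ≤ᵇ n ∸ K) * f (n ∸ K ∸ L))  ≡⟨ 𝟙≤ᵇ-*-𝟙≤ᵇ L K n _ ⟩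
  𝟙 (K + L ≤ᵇ n) * f (n ∸ K ∸ L)                 ≡⟨ cong (λ m → 𝟙 (K + L ≤ᵇ n) * f m) (∸-+-assoc n K L) ⟩
  shift (K + L) f n                              ∎

shift-recurrence-unique : ∀ k {f u v : Series} →
  (∀ n → u n ≡ f n + shift (suc k) u n) → (∀ n → v n ≡ f n + shift (suc k) v n) → u ≗ v
shift-recurrence-unique k {f} {u} {v} hu hv = <-rec (λ n → u n ≡ v n) step
  where
  step : ∀ n → (∀ {m} → m < n → u m ≡ v m) → u n ≡ v n
  step n ih = trans (hu n) (trans (cong (f n +_) (shift-cong-< k n (λ _ → ih))) (sym (hv n)))

weightedGeom-unfold : ∀ k ψ n → weightedGeom (suc k) ψ n ≡ ψ 0 n + shift (suc k) (weightedGeom (suc k) (ψ ∘ suc)) n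
weightedGeom-unfold k ψ n = cong₂ _+_ first rest
  where
  K = suc k
  first : 𝟙 (K * 0 ≤ᵇ n) * ψ 0 (n ∸ K * 0) ≡ ψ 0 n
  first rewrite *-zeroʳ K = *-identityˡ _
  rest : ∑ n (λ i → 𝟙 (K * suc i ≤ᵇ n) * ψ (suc i) (n ∸ K * suc i)) ≡ shift K (weightedGeom K (ψ ∘ suc)) n
  rest with K ≤? n
  ... | no K≰n = trans (∑-zero n (λ i _ → 𝟙≤ᵇ-*-> _ (<-≤-trans (≰⇒> K≰n) (m≤m*n K (suc i)))))
                       (sym (shift-> (weightedGeom K (ψ ∘ suc)) (≰⇒> K≰n)))
  ... | yes K≤n = begin
    ∑ n (λ i → 𝟙 (K * suc i ≤ᵇ n) * ψ (suc i) (n ∸ K * suc i))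
      ≡⟨ ∑-cong′ n peel ⟩
    ∑ n φ
      ≡⟨ ∑-truncate (suc (n ∸ K)) n (∸-monoʳ-< {n} {K} {0} (s≤s z≤n) K≤n)
                    (λ i n∸K<i _ → 𝟙≤ᵇ-*-> _ (<-≤-trans n∸K<i (m≤n*m i K))) ⟩
    ∑ (suc (n ∸ K)) φ
      ≡⟨ sym (shift-≤ (weightedGeom K (ψ ∘ suc)) K≤n) ⟩
    shift K (weightedGeom K (ψ ∘ suc)) n ∎
    where
    φ : ℕ → ℕ
    φ i = 𝟙 (K * i ≤ᵇ n ∸ K) * ψ (suc i) (n ∸ K ∸ K * i)
    peel : ∀ i → 𝟙 (K * suc i ≤ᵇ n) * ψ (suc i) (n ∸ K * suc i) ≡ φ i
    peel i = begin
      𝟙 (K * suc i ≤ᵇ n) * ψ (suc i) (n ∸ K * suc i)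
        ≡⟨ cong (λ m → 𝟙 (m ≤ᵇ n) * ψ (suc i) (n ∸ m)) (*-suc K i) ⟩
      𝟙 (K + K * i ≤ᵇ n) * ψ (suc i) (n ∸ (K + K * i))
        ≡⟨ cong (λ m → 𝟙 (K + K * i ≤ᵇ n) * ψ (suc i) m) (sym (∸-+-assoc n K (K * i))) ⟩
      𝟙 (K + K * i ≤ᵇ n) * ψ (suc i) (n ∸ K ∸ K * i)
        ≡⟨ sym (𝟙≤ᵇ-*-𝟙≤ᵇ (K * i) K n _) ⟩
      𝟙 (K ≤ᵇ n) * φ i
        ≡⟨ 𝟙≤ᵇ-*-≤ (φ i) K≤n ⟩
      φ i ∎

geom-unfold : ∀ k f n → geom (suc k) f n ≡ f n + shift (suc k) (geom (suc k) f) n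
geom-unfold k f = weightedGeom-unfold k (λ _ → f)

geom-unique : ∀ k {f u : Series} → (∀ n → u n ≡ f n + shift (suc k) u n) → u ≗ geom (suc k) f
geom-unique k hu = shift-recurrence-unique k hu (geom-unfold k _)

geom-cong : ∀ K {f g} → f ≗ g → geom K f ≗ geom K g
geom-cong K eq n = ∑-cong′ (suc n) (λ i → cong (𝟙 (K * i ≤ᵇ n) *_) (eq (n ∸ K * i)))

geom-one : geom 1 δ ≗ λ _ → 1
geom-one n = sym (geom-unique 0 one-rec n)
  where
  one-rec : ∀ n → 1 ≡ δ n + shift 1 (λ _ → 1) n
  one-rec zero    = refl
  one-rec (suc n) = refl

⊛-cong : ∀ {f f′ g g′} → f ≗ f′ → g ≗ g′ → f ⊛ g ≗ f′ ⊛ g′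
⊛-cong eqf eqg n = ∑-cong′ (suc n) (λ a → cong₂ _*_ (eqf a) (eqg (n ∸ a)))

⊛-comm : ∀ f g → f ⊛ g ≗ g ⊛ f
⊛-comm f g n = trans (∑-reverse n (λ a → f a * g (n ∸ a))) (∑-cong (suc n) swap)
  where
  swap : ∀ a → a < suc n → f (n ∸ a) * g (n ∸ (n ∸ a)) ≡ g a * f (n ∸ a)
  swap a a≤n = trans (cong (λ m → f (n ∸ a) * g m) (m∸[m∸n]≡n (s≤s⁻¹ a≤n))) (*-comm (f (n ∸ a)) (g a))

⊛-+ʳ : ∀ f g h → f ⊛ (λ m → g m + h m) ≗ λ n → (f ⊛ g) n + (f ⊛ h) n
⊛-+ʳ f g h n = trans (∑-cong′ (suc n) (λ a → *-distribˡ-+ (f a) (g (n ∸ a)) (h (n ∸ a))))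
                     (∑-+ (suc n) (λ a → f a * g (n ∸ a)) (λ a → f a * h (n ∸ a)))

⊛-δ : ∀ f → f ⊛ δ ≗ f
⊛-δ f n = begin
  ∑ (suc n) (λ a → f a * δ (n ∸ a))
    ≡⟨ ∑-reverse n (λ a → f a * δ (n ∸ a)) ⟩
  ∑ (suc n) (λ a → f (n ∸ a) * δ (n ∸ (n ∸ a)))
    ≡⟨ ∑-cong (suc n) (λ a a≤n → cong (λ m → f (n ∸ a) * δ m) (m∸[m∸n]≡n (s≤s⁻¹ a≤n))) ⟩
  f n * 1 + ∑ n (λ a → f (n ∸ suc a) * 0)
    ≡⟨ cong₂ _+_ (*-identityʳ (f n)) (∑-zero n (λ a _ → *-zeroʳ (f (n ∸ suc a)))) ⟩
  f n + 0
    ≡⟨ +-identityʳ (f n) ⟩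
  f n ∎

shift-⊛ : ∀ K f g → shift K f ⊛ g ≗ shift K (f ⊛ g)
shift-⊛ K f g n with K ≤? n
... | no K≰n =
  trans (∑-zero (suc n) (λ a a≤n → cong (_* g (n ∸ a)) (shift-> f (≤-<-trans (s≤s⁻¹ a≤n) (≰⇒> K≰n)))))
        (sym (shift-> (f ⊛ g) (≰⇒> K≰n)))
... | yes K≤n = begin
  ∑ (suc n) φ
    ≡⟨ cong (λ l → ∑ l φ) (sym K+[n∸K+1]) ⟩
  ∑ (K + suc (n ∸ K)) φ
    ≡⟨ ∑-split K (suc (n ∸ K)) φ ⟩
  ∑ K φ + ∑ (suc (n ∸ K)) (λ i → φ (K + i))
    ≡⟨ cong₂ _+_ (∑-zero K (λ a a<K → cong (_* g (n ∸ a)) (shift-> f a<K))) (∑-cong′ (suc (n ∸ K)) shifted) ⟩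
  (f ⊛ g) (n ∸ K)
    ≡⟨ sym (shift-≤ (f ⊛ g) K≤n) ⟩
  shift K (f ⊛ g) n ∎
  where
  φ : ℕ → ℕ
  φ a = shift K f a * g (n ∸ a)
  K+[n∸K+1] : K + suc (n ∸ K) ≡ suc n
  K+[n∸K+1] = trans (+-suc K (n ∸ K)) (cong suc (m+[n∸m]≡n K≤n))
  shifted : ∀ i → φ (K + i) ≡ f i * g (n ∸ K ∸ i)
  shifted i = cong₂ _*_ (trans (shift-≤ f (m≤m+n K i)) (cong f (m+n∸m≡n K i))) (cong g (sym (∸-+-assoc n K i)))

⊛-shift : ∀ K f g → f ⊛ shift K g ≗ shift K (f ⊛ g)
⊛-shift K f g n = begin
  (f ⊛ shift K g) n   ≡⟨ ⊛-comm f (shift K g) n ⟩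
  (shift K g ⊛ f) n   ≡⟨ shift-⊛ K g f n ⟩
  shift K (g ⊛ f) n   ≡⟨ shift-cong K (⊛-comm g f) n ⟩
  shift K (f ⊛ g) n   ∎

shift-⊛-shift : ∀ K L f g → shift K f ⊛ shift L g ≗ shift K (shift L (f ⊛ g))
shift-⊛-shift K L f g n = trans (shift-⊛ K f (shift L g) n) (shift-cong K (⊛-shift L f g) n)

⊛-geom : ∀ k f g → f ⊛ geom (suc k) g ≗ geom (suc k) (f ⊛ g)
⊛-geom k f g = geom-unique k rec
  where
  K = suc k
  rec : ∀ n → (f ⊛ geom K g) n ≡ (f ⊛ g) n + shift K (f ⊛ geom K g) n
  rec n = begin
    (f ⊛ geom K g) n                            ≡⟨ ⊛-cong {f} (λ _ → refl) (geom-unfold k g) n ⟩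
    (f ⊛ (λ m → g m + shift K (geom K g) m)) n  ≡⟨ ⊛-+ʳ f g (shift K (geom K g)) n ⟩
    (f ⊛ g) n + (f ⊛ shift K (geom K g)) n      ≡⟨ cong ((f ⊛ g) n +_) (⊛-shift K f (geom K g) n) ⟩
    (f ⊛ g) n + shift K (f ⊛ geom K g) n        ∎

geom-⊛-geom : ∀ k f g → geom (suc k) f ⊛ geom (suc k) g ≗ geom (suc k) (geom (suc k) (f ⊛ g))
geom-⊛-geom k f g n = begin
  (geom K f ⊛ geom K g) n        ≡⟨ ⊛-geom k (geom K f) g n ⟩
  geom K (geom K f ⊛ g) n        ≡⟨ geom-cong K (⊛-comm (geom K f) g) n ⟩
  geom K (g ⊛ geom K f) n        ≡⟨ geom-cong K (⊛-geom k g f) n ⟩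
  geom K (geom K (g ⊛ f)) n      ≡⟨ geom-cong K (geom-cong K (⊛-comm g f)) n ⟩
  geom K (geom K (f ⊛ g)) n      ∎
  where
  K = suc k

geom-geom : ∀ k f → geom (suc k) (geom (suc k) f) ≗ weightedGeom (suc k) (λ i m → suc i * f m)
geom-geom k f = λ n → sym (geom-unique k rec n)
  where
  K = suc k
  V = weightedGeom K (λ i m → suc i * f m)
  split : ∀ n → weightedGeom K (λ i m → suc (suc i) * f m) n ≡ geom K f n + V n
  split n = trans (∑-cong′ (suc n) (λ i → *-distribˡ-+ (gate i) (f (n ∸ K * i)) (term i)))
                  (∑-+ (suc n) (λ i → gate i * f (n ∸ K * i)) (λ i → gate i * term i))
    where
    gate term : ℕ → ℕ
    gate i = 𝟙 (K * i ≤ᵇ n)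
    term i = suc i * f (n ∸ K * i)
  rec : ∀ n → V n ≡ geom K f n + shift K V n
  rec n = begin
    V n
      ≡⟨ weightedGeom-unfold k (λ i m → suc i * f m) n ⟩
    1 * f n + shift K (weightedGeom K (λ i m → suc (suc i) * f m)) n
      ≡⟨ cong₂ _+_ (*-identityˡ (f n)) (shift-cong K split n) ⟩
    f n + shift K (λ m → geom K f m + V m) n
      ≡⟨ cong (f n +_) (*-distribˡ-+ (𝟙 (K ≤ᵇ n)) _ _) ⟩
    f n + (shift K (geom K f) n + shift K V n)
      ≡⟨ sym (+-assoc (f n) _ _) ⟩
    f n + shift K (geom K f) n + shift K V n
      ≡⟨ cong (_+ shift K V n) (sym (geom-unfold k f n)) ⟩
    geom K f n + shift K V n ∎

≤/⇒*≤ : ∀ k {i n} → i ≤ n / suc k → suc k * i ≤ n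
≤/⇒*≤ k {i} {n} i≤n/K =
  ≤-trans (*-monoʳ-≤ (suc k) i≤n/K) (subst (_≤ n) (*-comm (n / suc k) (suc k)) (m/n*n≤m n (suc k)))

weightedGeom-∑ : ∀ k ψ n → weightedGeom (suc k) ψ n ≡ ∑ (suc (n / suc k)) (λ i → ψ i (n ∸ suc k * i))
weightedGeom-∑ k ψ n = trans (∑-truncate (suc (n / K)) (suc n) (s≤s (m/n≤m n K)) beyond) (∑-cong (suc (n / K)) within)
  where
  K = suc k
  within : ∀ i → i < suc (n / K) → 𝟙 (K * i ≤ᵇ n) * ψ i (n ∸ K * i) ≡ ψ i (n ∸ K * i)
  within i i≤n/K = 𝟙≤ᵇ-*-≤ (ψ i (n ∸ K * i)) (≤/⇒*≤ k {i} {n} (s≤s⁻¹ i≤n/K))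
  beyond : ∀ i → suc (n / K) ≤ i → i < suc n → 𝟙 (K * i ≤ᵇ n) * ψ i (n ∸ K * i) ≡ 0
  beyond i n/K<i _ = 𝟙≤ᵇ-*-> _ (≰⇒> λ Ki≤n →
    <⇒≱ n/K<i (subst (_≤ n / K) (m*n/n≡m i K) (/-monoˡ-≤ K (subst (_≤ n) (*-comm K i) Ki≤n))))

-- Partition numbers

-- topPart lo c Q M t: choose a largest part x ∈ [lo, M] occurring c times,
-- and complete it by one of the Q x (t ∸ c x) configurations below it.
topPart : (lo c : ℕ) → (ℕ → Series) → ℕ → ℕ → ℕ
topPart lo c Q M t = ∑ (suc M) (λ x → 𝟙 ((lo ≤ᵇ x) ∧ (c * x ≤ᵇ t)) * Q x (t ∸ c * x))

-- partitions lo k M t: non-increasing k-vectors with entries in [lo, M] and sum t.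
partitions : (lo k : ℕ) → ℕ → Series
partitions lo zero    M = δ
partitions lo (suc k)   = topPart lo 1 (partitions lo k)

atMost : ℕ → Series
atMost k n = partitions 0 k n n

-- Generating function 1 / (q²; q)ₖ; for k ≥ 1 it counts the partitions with
-- at most k + 1 parts whose two largest parts (zeros included) are equal.
twinTop : ℕ → Series
twinTop zero      = δ
twinTop (suc k) m = topPart 0 2 (partitions 0 k) m m

topPart-+ : ∀ lo c (Q R S : ℕ → Series) M t → (∀ x s → Q x s ≡ R x s + S x s) →
  topPart lo c Q M t ≡ topPart lo c R M t + topPart lo c S M t
topPart-+ lo c Q R S M t eq = trans (∑-cong′ (suc M) distrib) (∑-+ (suc M) (λ x → gate x * rest R x) (λ x → gate x * rest S x))
  where
  gate : ℕ → ℕ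
  gate x = 𝟙 ((lo ≤ᵇ x) ∧ (c * x ≤ᵇ t))
  rest : (ℕ → Series) → ℕ → ℕ
  rest P x = P x (t ∸ c * x)
  distrib : ∀ x → gate x * rest Q x ≡ gate x * rest R x + gate x * rest S x
  distrib x = trans (cong (gate x *_) (eq x (t ∸ c * x))) (*-distribˡ-+ (gate x) (rest R x) (rest S x))

topPart-positive : ∀ c (Q : ℕ → Series) M t → (∀ s → Q 0 s ≡ 0) → topPart 0 c Q M t ≡ topPart 1 c Q M t
topPart-positive c Q M t Q0≡0 = ∑-cong′ (suc M) same
  where
  same : ∀ x → 𝟙 ((0 ≤ᵇ x) ∧ (c * x ≤ᵇ t)) * Q x (t ∸ c * x)
             ≡ 𝟙 ((1 ≤ᵇ x) ∧ (c * x ≤ᵇ t)) * Q x (t ∸ c * x)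
  same zero    = trans (cong (𝟙 (c * 0 ≤ᵇ t) *_) (Q0≡0 _)) (*-zeroʳ (𝟙 (c * 0 ≤ᵇ t)))
  same (suc x) = refl

topPart-bound : ∀ lo c Q {M M′ t} → t ≤ M → t ≤ M′ → topPart lo (suc c) Q M t ≡ topPart lo (suc c) Q M′ t
topPart-bound lo c Q {M} {M′} {t} t≤M t≤M′ = trans (to-t t≤M) (sym (to-t t≤M′))
  where
  beyond : ∀ x → t < x → 𝟙 ((lo ≤ᵇ x) ∧ (suc c * x ≤ᵇ t)) * Q x (t ∸ suc c * x) ≡ 0
  beyond x t<x = trans (cong (λ b → 𝟙 ((lo ≤ᵇ x) ∧ b) * Q x (t ∸ suc c * x))
                             (≤ᵇ-false (<-≤-trans t<x (m≤n*m x (suc c)))))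
                       (cong (λ b → 𝟙 b * Q x (t ∸ suc c * x)) (∧-zeroʳ (lo ≤ᵇ x)))
  to-t : ∀ {N} → t ≤ N → topPart lo (suc c) Q N t ≡ topPart lo (suc c) Q t t
  to-t {N} t≤N = ∑-truncate (suc t) (suc N) (s≤s t≤N) (λ x t<x _ → beyond x t<x)

-- Subtracting 1 from each part of the configurations counted by Q′.
topPart-lower : ∀ lo c j (Q′ Q : ℕ → Series) M t → (∀ x → Q′ (suc x) ≗ shift j (Q x)) →
  topPart (suc lo) c Q′ (suc M) t ≡ shift (c + j) (topPart lo c Q M) t
topPart-lower lo c j Q′ Q M t lower = begin
  ∑ (suc M) (λ i → 𝟙 ((suc lo ≤ᵇ suc i) ∧ (c * suc i ≤ᵇ t)) * Q′ (suc i) (t ∸ c * suc i))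
    ≡⟨ ∑-cong′ (suc M) (λ i → trans (lhs i) (sym (rhs i))) ⟩
  ∑ (suc M) (λ i → 𝟙 (c + j ≤ᵇ t) * term i)
    ≡⟨ ∑-*ˡ (suc M) (𝟙 (c + j ≤ᵇ t)) term ⟩
  shift (c + j) (topPart lo c Q M) t ∎
  where
  term : ℕ → ℕ
  term i = 𝟙 ((lo ≤ᵇ i) ∧ (c * i ≤ᵇ t ∸ (c + j))) * Q i (t ∸ (c + j) ∸ c * i)
  normal : ℕ → ℕ
  normal i = 𝟙 (lo ≤ᵇ i) * (𝟙 (c + j + c * i ≤ᵇ t) * Q i (t ∸ (c + j + c * i)))
  offset : ∀ c j i → c * suc i + j ≡ c + j + c * i
  offset = solve-∀
  *-left-comm : ∀ a b d → a * (b * d) ≡ b * (a * d)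
  *-left-comm = solve-∀
  lhs : ∀ i → 𝟙 ((suc lo ≤ᵇ suc i) ∧ (c * suc i ≤ᵇ t)) * Q′ (suc i) (t ∸ c * suc i) ≡ normal i
  lhs i = begin
    𝟙 ((suc lo ≤ᵇ suc i) ∧ (c * suc i ≤ᵇ t)) * Q′ (suc i) (t ∸ c * suc i)
      ≡⟨ cong₂ (λ b y → 𝟙 (b ∧ (c * suc i ≤ᵇ t)) * y) (suc-≤ᵇ-suc lo i) (lower i (t ∸ c * suc i)) ⟩
    𝟙 ((lo ≤ᵇ i) ∧ (c * suc i ≤ᵇ t)) * (𝟙 (j ≤ᵇ t ∸ c * suc i) * Q i (t ∸ c * suc i ∸ j))
      ≡⟨ sym (𝟙-∧-* (lo ≤ᵇ i) (c * suc i ≤ᵇ t) _) ⟩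
    𝟙 (lo ≤ᵇ i) * (𝟙 (c * suc i ≤ᵇ t) * (𝟙 (j ≤ᵇ t ∸ c * suc i) * Q i (t ∸ c * suc i ∸ j)))
      ≡⟨ cong (𝟙 (lo ≤ᵇ i) *_) (𝟙≤ᵇ-*-𝟙≤ᵇ j (c * suc i) t _) ⟩
    𝟙 (lo ≤ᵇ i) * (𝟙 (c * suc i + j ≤ᵇ t) * Q i (t ∸ c * suc i ∸ j))
      ≡⟨ cong (λ m → 𝟙 (lo ≤ᵇ i) * (𝟙 (c * suc i + j ≤ᵇ t) * Q i m)) (∸-+-assoc t (c * suc i) j) ⟩
    𝟙 (lo ≤ᵇ i) * (𝟙 (c * suc i + j ≤ᵇ t) * Q i (t ∸ (c * suc i + j)))
      ≡⟨ cong (λ S → 𝟙 (lo ≤ᵇ i) * (𝟙 (S ≤ᵇ t) * Q i (t ∸ S))) (offset c j i) ⟩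
    normal i ∎
  rhs : ∀ i → 𝟙 (c + j ≤ᵇ t) * term i ≡ normal i
  rhs i = begin
    𝟙 (c + j ≤ᵇ t) * (𝟙 ((lo ≤ᵇ i) ∧ (c * i ≤ᵇ t ∸ (c + j))) * Q i (t ∸ (c + j) ∸ c * i))
      ≡⟨ cong (𝟙 (c + j ≤ᵇ t) *_) (sym (𝟙-∧-* (lo ≤ᵇ i) _ _)) ⟩
    𝟙 (c + j ≤ᵇ t) * (𝟙 (lo ≤ᵇ i) * (𝟙 (c * i ≤ᵇ t ∸ (c + j)) * Q i (t ∸ (c + j) ∸ c * i)))
      ≡⟨ *-left-comm (𝟙 (c + j ≤ᵇ t)) (𝟙 (lo ≤ᵇ i)) _ ⟩
    𝟙 (lo ≤ᵇ i) * (𝟙 (c + j ≤ᵇ t) * (𝟙 (c * i ≤ᵇ t ∸ (c + j)) * Q i (t ∸ (c + j) ∸ c * i)))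
      ≡⟨ cong (𝟙 (lo ≤ᵇ i) *_) (𝟙≤ᵇ-*-𝟙≤ᵇ (c * i) (c + j) t _) ⟩
    𝟙 (lo ≤ᵇ i) * (𝟙 (c + j + c * i ≤ᵇ t) * Q i (t ∸ (c + j) ∸ c * i))
      ≡⟨ cong (λ m → 𝟙 (lo ≤ᵇ i) * (𝟙 (c + j + c * i ≤ᵇ t) * Q i m)) (∸-+-assoc t (c + j) (c * i)) ⟩
    normal i ∎

partitions-bound : ∀ lo k {M M′ t} → t ≤ M → t ≤ M′ → partitions lo k M t ≡ partitions lo k M′ t
partitions-bound lo zero    t≤M t≤M′ = refl
partitions-bound lo (suc k) t≤M t≤M′ = topPart-bound lo 0 (partitions lo k) t≤M t≤M′

partitions-lower : ∀ lo k M → partitions (suc lo) k (suc M) ≗ shift k (partitions lo k M)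
partitions-lower lo zero    M t = sym (*-identityˡ (δ t))
partitions-lower lo (suc k) M t =
  topPart-lower lo 1 k (partitions (suc lo) k) (partitions lo k) M t (partitions-lower lo k)

mutual
  -- Either the smallest of the k + 1 parts is 0, or all of them are positive.
  partitions-split : ∀ k M t → partitions 0 (suc k) M t ≡ partitions 0 k M t + partitions 1 (suc k) M t
  partitions-split zero    M t = cong (_+ ∑ M (λ i → 𝟙 (1 * suc i ≤ᵇ t) * δ (t ∸ 1 * suc i))) (*-identityˡ (δ t))
  partitions-split (suc k) M t = topPart-split 1 k M t

  topPart-split : ∀ c k M t → topPart 0 c (partitions 0 (suc k)) M t
                              ≡ topPart 0 c (partitions 0 k) M t + topPart 1 c (partitions 1 (suc k)) M t
  topPart-split c k M t =
    trans (topPart-+ 0 c (partitions 0 (suc k)) (partitions 0 k) (partitions 1 (suc k)) M t (partitions-split k))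
          (cong (topPart 0 c (partitions 0 k) M t +_)
                (topPart-positive c (partitions 1 (suc k)) M t (λ _ → refl)))

topPart-exactly : ∀ c k {M t} → t ≤ M →
  topPart 1 (suc c) (partitions 1 k) M t ≡ shift (suc c + k) (λ m → topPart 0 (suc c) (partitions 0 k) m m) t
topPart-exactly c k {M} {t} t≤M = begin
  topPart 1 (suc c) (partitions 1 k) M t
    ≡⟨ topPart-bound 1 c (partitions 1 k) t≤M (n≤1+n t) ⟩
  topPart 1 (suc c) (partitions 1 k) (suc t) t
    ≡⟨ topPart-lower 0 (suc c) k (partitions 1 k) (partitions 0 k) t t (partitions-lower 0 k) ⟩
  shift K (topPart 0 (suc c) (partitions 0 k) t) t
    ≡⟨ cong (𝟙 (K ≤ᵇ t) *_) (topPart-bound 0 c (partitions 0 k) (m∸n≤m t K) ≤-refl) ⟩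
  shift K (λ m → topPart 0 (suc c) (partitions 0 k) m m) t ∎
  where
  K = suc c + k

partitions-exactly : ∀ k {M t} → t ≤ M → partitions 1 k M t ≡ shift k (atMost k) t
partitions-exactly zero    {t = t} _ = sym (*-identityˡ (δ t))
partitions-exactly (suc k)       t≤M = topPart-exactly 0 k t≤M

atMost-geom : ∀ k → atMost (suc k) ≗ geom (suc k) (atMost k)
atMost-geom k = geom-unique k rec
  where
  rec : ∀ n → atMost (suc k) n ≡ atMost k n + shift (suc k) (atMost (suc k)) n
  rec n = trans (partitions-split k n n) (cong (atMost k n +_) (partitions-exactly (suc k) (≤-refl {n})))

twinTop-geom : ∀ k → twinTop (suc k) ≗ geom (suc (suc k)) (twinTop k)
twinTop-geom zero    m = refl
twinTop-geom (suc k) = geom-unique (suc (suc k)) rec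
  where
  K = suc (suc (suc k))
  rec : ∀ m → twinTop (suc (suc k)) m ≡ twinTop (suc k) m + shift K (twinTop (suc (suc k))) m
  rec m = trans (topPart-split 2 k m m) (cong (twinTop (suc k) m +_) (topPart-exactly 1 (suc k) (≤-refl {m})))

atMost-one : atMost 1 ≗ λ _ → 1
atMost-one n = trans (atMost-geom 0 n) (geom-one n)

-- Counting the enumerated vectors

sumOver : {A : Set} → List A → (A → ℕ) → ℕ
sumOver xs f = sum (map f xs)

sumOver-++ : {A : Set} (xs ys : List A) (f : A → ℕ) → sumOver (xs ++ ys) f ≡ sumOver xs f + sumOver ys f
sumOver-++ xs ys f = trans (cong sum (map-++ f xs ys)) (sum-++ (map f xs) (map f ys))

sumOver-map : {A B : Set} (e : A → B) (xs : List A) (f : B → ℕ) → sumOver (map e xs) f ≡ sumOver xs (f ∘ e)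
sumOver-map e xs f = cong sum (sym (map-∘ xs))

sumOver-concatMap : {A B : Set} (e : A → List B) (xs : List A) (f : B → ℕ) →
  sumOver (concatMap e xs) f ≡ sumOver xs (λ x → sumOver (e x) f)
sumOver-concatMap e []       f = refl
sumOver-concatMap e (x ∷ xs) f =
  trans (sumOver-++ (e x) (concatMap e xs) f) (cong (sumOver (e x) f +_) (sumOver-concatMap e xs f))

sumOver-cartesianProduct : {A B : Set} (xs : List A) (ys : List B) (f : A × B → ℕ) →
  sumOver (cartesianProduct xs ys) f ≡ sumOver xs (λ x → sumOver ys (λ y → f (x , y)))
sumOver-cartesianProduct []       ys f = refl
sumOver-cartesianProduct (x ∷ xs) ys f =
  trans (sumOver-++ (map (x ,_) ys) (cartesianProduct xs ys) f)
        (cong₂ _+_ (sumOver-map (x ,_) ys f) (sumOver-cartesianProduct xs ys f))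

length-filterᵇ : {A : Set} (p : A → Bool) (xs : List A) → length (filterᵇ p xs) ≡ sumOver xs (𝟙 ∘ p)
length-filterᵇ p []       = refl
length-filterᵇ p (x ∷ xs) with p x
... | true  = cong suc (length-filterᵇ p xs)
... | false = length-filterᵇ p xs

∑ᵛ : (k N : ℕ) → (Vec ℕ k → ℕ) → ℕ
∑ᵛ zero    N f = f []
∑ᵛ (suc k) N f = ∑ (suc N) (λ x → ∑ᵛ k N (f ∘ (x ∷_)))

sumOver-allVecs : ∀ k N f → sumOver (allVecs k N) f ≡ ∑ᵛ k N f
sumOver-allVecs zero    N f = +-identityʳ (f [])
sumOver-allVecs (suc k) N f = begin
  sumOver (concatMap (λ x → map (x ∷_) (allVecs k N)) (upTo (suc N))) f
    ≡⟨ sumOver-concatMap (λ x → map (x ∷_) (allVecs k N)) (upTo (suc N)) f ⟩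
  Σ< (suc N) (λ x → sumOver (map (x ∷_) (allVecs k N)) f)
    ≡⟨ Σ<≡∑ (suc N) _ ⟩
  ∑ (suc N) (λ x → sumOver (map (x ∷_) (allVecs k N)) f)
    ≡⟨ ∑-cong′ (suc N) (λ x → trans (sumOver-map (x ∷_) (allVecs k N) f) (sumOver-allVecs k N (f ∘ (x ∷_)))) ⟩
  ∑ᵛ (suc k) N f ∎

∑ᵛ-cong : ∀ k N {f g} → f ≗ g → ∑ᵛ k N f ≡ ∑ᵛ k N g
∑ᵛ-cong zero    N eq = eq []
∑ᵛ-cong (suc k) N eq = ∑-cong′ (suc N) (λ x → ∑ᵛ-cong k N (eq ∘ (x ∷_)))

∑ᵛ-*ˡ : ∀ k N c f → ∑ᵛ k N (λ v → c * f v) ≡ c * ∑ᵛ k N f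
∑ᵛ-*ˡ zero    N c f = refl
∑ᵛ-*ˡ (suc k) N c f =
  trans (∑-cong′ (suc N) (λ x → ∑ᵛ-*ˡ k N c (f ∘ (x ∷_)))) (∑-*ˡ (suc N) c (λ x → ∑ᵛ k N (f ∘ (x ∷_))))

∑ᵛ-*ʳ : ∀ k N c f → ∑ᵛ k N (λ v → f v * c) ≡ ∑ᵛ k N f * c
∑ᵛ-*ʳ k N c f = trans (∑ᵛ-cong k N (λ v → *-comm (f v) c)) (trans (∑ᵛ-*ˡ k N c f) (*-comm c _))

∑ᵛ-∑ : ∀ k N m (f : Vec ℕ k → ℕ → ℕ) → ∑ᵛ k N (λ v → ∑ m (f v)) ≡ ∑ m (λ i → ∑ᵛ k N (λ v → f v i))
∑ᵛ-∑ zero    N m f = refl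
∑ᵛ-∑ (suc k) N m f = trans (∑-cong′ (suc N) (λ x → ∑ᵛ-∑ k N m (f ∘ (x ∷_))))
                           (∑-comm (suc N) m (λ x i → ∑ᵛ k N (λ v → f (x ∷ v) i)))

count : (k N : ℕ) → (Vec ℕ k → Bool) → Series
count k N p t = ∑ᵛ k N (λ v → 𝟙 (p v ∧ (vsum v ≡ᵇ t)))

count-cong : ∀ k N {p p′ : Vec ℕ k → Bool} → (∀ v → p v ≡ p′ v) → count k N p ≗ count k N p′
count-cong k N eq t = ∑ᵛ-cong k N (λ v → cong (λ b → 𝟙 (b ∧ (vsum v ≡ᵇ t))) (eq v))

<ᵇ-suc : ∀ x n → (x <ᵇ suc n) ≡ (x ≤ᵇ n)
<ᵇ-suc zero    n = refl
<ᵇ-suc (suc x) n = refl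

𝟙-+-≡ᵇ : ∀ x y n → 𝟙 (x + y ≡ᵇ n) ≡ ∑ (suc n) (λ s → 𝟙 (x ≡ᵇ s) * 𝟙 (y ≡ᵇ n ∸ s))
𝟙-+-≡ᵇ x y n = begin
  𝟙 (x + y ≡ᵇ n)                                 ≡⟨ cong 𝟙 (+-≡ᵇ x y n) ⟩
  𝟙 ((x ≤ᵇ n) ∧ (y ≡ᵇ n ∸ x))                    ≡⟨ 𝟙-∧ (x ≤ᵇ n) _ ⟩
  𝟙 (x ≤ᵇ n) * 𝟙 (y ≡ᵇ n ∸ x)                    ≡⟨ cong (λ b → 𝟙 b * 𝟙 (y ≡ᵇ n ∸ x)) (sym (<ᵇ-suc x n)) ⟩
  𝟙 (x <ᵇ suc n) * 𝟙 (y ≡ᵇ n ∸ x)                ≡⟨ sym (∑-select (suc n) x (λ s → 𝟙 (y ≡ᵇ n ∸ s))) ⟩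
  ∑ (suc n) (λ s → 𝟙 (x ≡ᵇ s) * 𝟙 (y ≡ᵇ n ∸ s))  ∎

count-pairs : ∀ k N n (p q : Vec ℕ k → Bool) (r : Vec ℕ k × Vec ℕ k → Bool) →
  (∀ a b → r (a , b) ≡ p a ∧ (q b ∧ (vsum a + vsum b ≡ᵇ n))) →
  length (filterᵇ r (cartesianProduct (allVecs k N) (allVecs k N))) ≡ (count k N p ⊛ count k N q) n
count-pairs k N n p q r r≡ = begin
  length (filterᵇ r (cartesianProduct (allVecs k N) (allVecs k N)))
    ≡⟨ length-filterᵇ r (cartesianProduct (allVecs k N) (allVecs k N)) ⟩
  sumOver (cartesianProduct (allVecs k N) (allVecs k N)) (𝟙 ∘ r)
    ≡⟨ sumOver-cartesianProduct (allVecs k N) (allVecs k N) (𝟙 ∘ r) ⟩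
  sumOver (allVecs k N) (λ a → sumOver (allVecs k N) (λ b → 𝟙 (r (a , b))))
    ≡⟨ trans (sumOver-allVecs k N _) (∑ᵛ-cong k N (λ a → sumOver-allVecs k N _)) ⟩
  ∑ᵛ k N (λ a → ∑ᵛ k N (λ b → 𝟙 (r (a , b))))
    ≡⟨ ∑ᵛ-cong k N (λ a → trans (∑ᵛ-cong k N (separate a)) (∑ᵛ-∑ k N (suc n) (λ b s → X a s * Y b s))) ⟩
  ∑ᵛ k N (λ a → ∑ (suc n) (λ s → ∑ᵛ k N (λ b → X a s * Y b s)))
    ≡⟨ ∑ᵛ-cong k N (λ a → ∑-cong′ (suc n) (λ s → ∑ᵛ-*ˡ k N (X a s) (λ b → Y b s))) ⟩
  ∑ᵛ k N (λ a → ∑ (suc n) (λ s → X a s * count k N q (n ∸ s)))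
    ≡⟨ ∑ᵛ-∑ k N (suc n) (λ a s → X a s * count k N q (n ∸ s)) ⟩
  ∑ (suc n) (λ s → ∑ᵛ k N (λ a → X a s * count k N q (n ∸ s)))
    ≡⟨ ∑-cong′ (suc n) (λ s → ∑ᵛ-*ʳ k N (count k N q (n ∸ s)) (λ a → X a s)) ⟩
  (count k N p ⊛ count k N q) n ∎
  where
  X Y : Vec ℕ k → ℕ → ℕ
  X a s = 𝟙 (p a ∧ (vsum a ≡ᵇ s))
  Y b s = 𝟙 (q b ∧ (vsum b ≡ᵇ n ∸ s))
  regroup : ∀ a b c d → a * (b * (c * d)) ≡ (a * c) * (b * d)
  regroup = solve-∀
  separate : ∀ a b → 𝟙 (r (a , b)) ≡ ∑ (suc n) (λ s → X a s * Y b s)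
  separate a b = begin
    𝟙 (r (a , b))
      ≡⟨ cong 𝟙 (r≡ a b) ⟩
    𝟙 (p a ∧ (q b ∧ (vsum a + vsum b ≡ᵇ n)))
      ≡⟨ trans (𝟙-∧ (p a) _) (cong (𝟙 (p a) *_) (𝟙-∧ (q b) _)) ⟩
    𝟙 (p a) * (𝟙 (q b) * 𝟙 (vsum a + vsum b ≡ᵇ n))
      ≡⟨ cong (λ z → 𝟙 (p a) * (𝟙 (q b) * z)) (𝟙-+-≡ᵇ (vsum a) (vsum b) n) ⟩
    𝟙 (p a) * (𝟙 (q b) * ∑ (suc n) split)
      ≡⟨ cong (𝟙 (p a) *_) (sym (∑-*ˡ (suc n) (𝟙 (q b)) split)) ⟩
    𝟙 (p a) * ∑ (suc n) (λ s → 𝟙 (q b) * split s)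
      ≡⟨ sym (∑-*ˡ (suc n) (𝟙 (p a)) (λ s → 𝟙 (q b) * split s)) ⟩
    ∑ (suc n) (λ s → 𝟙 (p a) * (𝟙 (q b) * split s))
      ≡⟨ ∑-cong′ (suc n) (λ s → trans (regroup (𝟙 (p a)) (𝟙 (q b)) (𝟙 (vsum a ≡ᵇ s)) (𝟙 (vsum b ≡ᵇ n ∸ s)))
                                      (sym (cong₂ _*_ (𝟙-∧ (p a) _) (𝟙-∧ (q b) _)))) ⟩
    ∑ (suc n) (λ s → X a s * Y b s) ∎
    where
    split : ℕ → ℕ
    split s = 𝟙 (vsum a ≡ᵇ s) * 𝟙 (vsum b ≡ᵇ n ∸ s)

allAtLeastᵇ : {k : ℕ} → ℕ → Vec ℕ k → Bool
allAtLeastᵇ lo []       = true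
allAtLeastᵇ lo (x ∷ xs) = (lo ≤ᵇ x) ∧ allAtLeastᵇ lo xs

partitionᵇ : {k : ℕ} → ℕ → Vec ℕ k → Bool
partitionᵇ lo v = nonincᵇ v ∧ allAtLeastᵇ lo v

allAtLeastᵇ-0 : ∀ {k} (v : Vec ℕ k) → allAtLeastᵇ 0 v ≡ true
allAtLeastᵇ-0 []       = refl
allAtLeastᵇ-0 (x ∷ xs) = allAtLeastᵇ-0 xs

posᵇ≡allAtLeastᵇ-1 : ∀ {k} (v : Vec ℕ k) → posᵇ v ≡ allAtLeastᵇ 1 v
posᵇ≡allAtLeastᵇ-1 []       = refl
posᵇ≡allAtLeastᵇ-1 (x ∷ xs) = cong ((1 ≤ᵇ x) ∧_) (posᵇ≡allAtLeastᵇ-1 xs)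

partitions-suc : ∀ lo k M t →
  partitions lo (suc k) M t ≡ ∑ (suc M) (λ y → 𝟙 ((lo ≤ᵇ y) ∧ (y ≤ᵇ t)) * partitions lo k y (t ∸ y))
partitions-suc lo k M t =
  ∑-cong′ (suc M) (λ y → cong (λ m → 𝟙 ((lo ≤ᵇ y) ∧ (m ≤ᵇ t)) * partitions lo k y (t ∸ m)) (*-identityˡ y))

count-cons : ∀ lo k N x t → x ≤ N →
  ∑ᵛ k N (λ w → 𝟙 (partitionᵇ lo (x ∷ w) ∧ (x + vsum w ≡ᵇ t)))
  ≡ 𝟙 ((lo ≤ᵇ x) ∧ (x ≤ᵇ t)) * partitions lo k x (t ∸ x)
count-cons lo zero    N x t _ = begin
  𝟙 (((lo ≤ᵇ x) ∧ true) ∧ (x + 0 ≡ᵇ t))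
    ≡⟨ cong₂ (λ a b → 𝟙 (a ∧ b)) (∧-identityʳ (lo ≤ᵇ x)) (+-≡ᵇ x 0 t) ⟩
  𝟙 ((lo ≤ᵇ x) ∧ ((x ≤ᵇ t) ∧ (0 ≡ᵇ t ∸ x)))
    ≡⟨ cong 𝟙 (sym (∧-assoc (lo ≤ᵇ x) (x ≤ᵇ t) _)) ⟩
  𝟙 (((lo ≤ᵇ x) ∧ (x ≤ᵇ t)) ∧ (0 ≡ᵇ t ∸ x))
    ≡⟨ 𝟙-∧ ((lo ≤ᵇ x) ∧ (x ≤ᵇ t)) _ ⟩
  𝟙 ((lo ≤ᵇ x) ∧ (x ≤ᵇ t)) * δ (t ∸ x) ∎
count-cons lo (suc k) N x t x≤N = begin
  ∑ (suc N) (λ y → ∑ᵛ k N (λ w → 𝟙 (partitionᵇ lo (x ∷ y ∷ w) ∧ (x + (y + vsum w) ≡ᵇ t))))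
    ≡⟨ ∑-cong′ (suc N) (λ y → ∑ᵛ-cong k N (λ w → trans (cong 𝟙 (reorder y w)) (𝟙-∧ gate (rest y w)))) ⟩
  ∑ (suc N) (λ y → ∑ᵛ k N (λ w → 𝟙 gate * 𝟙 (rest y w)))
    ≡⟨ ∑-cong′ (suc N) (λ y → ∑ᵛ-*ˡ k N (𝟙 gate) (𝟙 ∘ rest y)) ⟩
  ∑ (suc N) (λ y → 𝟙 gate * ∑ᵛ k N (𝟙 ∘ rest y))
    ≡⟨ ∑-*ˡ (suc N) (𝟙 gate) (λ y → ∑ᵛ k N (𝟙 ∘ rest y)) ⟩
  𝟙 gate * ∑ (suc N) (λ y → ∑ᵛ k N (𝟙 ∘ rest y))
    ≡⟨ cong (𝟙 gate *_) (∑-cong (suc N) (λ y y≤N → below y (s≤s⁻¹ y≤N))) ⟩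
  𝟙 gate * ∑ (suc N) (λ y → 𝟙 (y ≤ᵇ x) * smaller y)
    ≡⟨ cong (𝟙 gate *_) (trans (∑-gate x N smaller x≤N) (sym (partitions-suc lo k x (t ∸ x)))) ⟩
  𝟙 gate * partitions lo (suc k) x (t ∸ x) ∎
  where
  gate : Bool
  gate = (lo ≤ᵇ x) ∧ (x ≤ᵇ t)
  rest : ℕ → Vec ℕ k → Bool
  rest y w = (y ≤ᵇ x) ∧ (partitionᵇ lo (y ∷ w) ∧ (y + vsum w ≡ᵇ t ∸ x))
  smaller : ℕ → ℕ
  smaller y = 𝟙 ((lo ≤ᵇ y) ∧ (y ≤ᵇ t ∸ x)) * partitions lo k y (t ∸ x ∸ y)
  reorder : ∀ y w → partitionᵇ lo (x ∷ y ∷ w) ∧ (x + (y + vsum w) ≡ᵇ t) ≡ gate ∧ rest y w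
  reorder y w = trans (cong (partitionᵇ lo (x ∷ y ∷ w) ∧_) (+-≡ᵇ x (y + vsum w) t))
    (solve 7 (λ Y Nn L Ly A E S → ((Y ⊕ Nn) ⊕ (L ⊕ (Ly ⊕ A))) ⊕ (E ⊕ S) ⊜ (L ⊕ E) ⊕ (Y ⊕ ((Nn ⊕ (Ly ⊕ A)) ⊕ S)))
       refl (y ≤ᵇ x) (nonincᵇ (y ∷ w)) (lo ≤ᵇ x) (lo ≤ᵇ y) (allAtLeastᵇ lo w) (x ≤ᵇ t) (y + vsum w ≡ᵇ t ∸ x))
  below : ∀ y → y ≤ N → ∑ᵛ k N (𝟙 ∘ rest y) ≡ 𝟙 (y ≤ᵇ x) * smaller y
  below y y≤N = begin
    ∑ᵛ k N (𝟙 ∘ rest y)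
      ≡⟨ ∑ᵛ-cong k N (λ w → 𝟙-∧ (y ≤ᵇ x) _) ⟩
    ∑ᵛ k N (λ w → 𝟙 (y ≤ᵇ x) * 𝟙 (partitionᵇ lo (y ∷ w) ∧ (y + vsum w ≡ᵇ t ∸ x)))
      ≡⟨ ∑ᵛ-*ˡ k N (𝟙 (y ≤ᵇ x)) (λ w → 𝟙 (partitionᵇ lo (y ∷ w) ∧ (y + vsum w ≡ᵇ t ∸ x))) ⟩
    𝟙 (y ≤ᵇ x) * ∑ᵛ k N (λ w → 𝟙 (partitionᵇ lo (y ∷ w) ∧ (y + vsum w ≡ᵇ t ∸ x)))
      ≡⟨ cong (𝟙 (y ≤ᵇ x) *_) (count-cons lo k N y (t ∸ x) y≤N) ⟩
    𝟙 (y ≤ᵇ x) * smaller y ∎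

count-partitions : ∀ lo k N t → count k N (partitionᵇ lo) t ≡ partitions lo k N t
count-partitions lo zero    N t = refl
count-partitions lo (suc k) N t =
  trans (∑-cong (suc N) (λ x x≤N → count-cons lo k N x t (s≤s⁻¹ x≤N))) (sym (partitions-suc lo k N t))

count-atMost : ∀ k {N t} → t ≤ N → count k N atMostᵇ t ≡ atMost k t
count-atMost k {N} {t} t≤N = begin
  count k N atMostᵇ t
    ≡⟨ count-cong k N (λ v → sym (trans (cong (nonincᵇ v ∧_) (allAtLeastᵇ-0 v)) (∧-identityʳ _))) t ⟩
  count k N (partitionᵇ 0) t
    ≡⟨ count-partitions 0 k N t ⟩
  partitions 0 k N t
    ≡⟨ partitions-bound 0 k t≤N ≤-refl ⟩
  atMost k t ∎

count-exactly : ∀ k {N t} → t ≤ N → count k N exactlyᵇ t ≡ shift k (atMost k) t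
count-exactly k {N} {t} t≤N = begin
  count k N exactlyᵇ t         ≡⟨ count-cong k N (λ v → cong (nonincᵇ v ∧_) (posᵇ≡allAtLeastᵇ-1 v)) t ⟩
  count k N (partitionᵇ 1) t   ≡⟨ count-partitions 1 k N t ⟩
  partitions 1 k N t           ≡⟨ partitions-exactly k t≤N ⟩
  shift k (atMost k) t         ∎

count-twinTop : ∀ k {N t} → t ≤ N →
  count (suc (suc k)) N (λ b → exactlyᵇ b ∧ topTwiceᵇ b) t ≡ shift (suc (suc k)) (twinTop (suc k)) t
count-twinTop k {N} {t} t≤N = begin
  ∑ (suc N) (λ x → ∑ (suc N) (λ y → ∑ᵛ k N (𝟙 ∘ topPair x y)))
    ≡⟨ ∑-cong (suc N) (λ x x≤N → trans (select x (s≤s⁻¹ x≤N)) (twin x (s≤s⁻¹ x≤N))) ⟩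
  topPart 1 2 (partitions 1 k) N t
    ≡⟨ topPart-exactly 1 k t≤N ⟩
  shift (suc (suc k)) (twinTop (suc k)) t ∎
  where
  topPair pair : ℕ → ℕ → Vec ℕ k → Bool
  topPair x y w = (exactlyᵇ (x ∷ y ∷ w) ∧ (x ≡ᵇ y)) ∧ (x + (y + vsum w) ≡ᵇ t)
  pair    x y w = exactlyᵇ (x ∷ y ∷ w) ∧ (x + (y + vsum w) ≡ᵇ t)
  ∧-right-comm : ∀ a b c → (a ∧ b) ∧ c ≡ b ∧ (a ∧ c)
  ∧-right-comm = solve 3 (λ a b c → (a ⊕ b) ⊕ c ⊜ b ⊕ (a ⊕ c)) refl
  select : ∀ x → x ≤ N → ∑ (suc N) (λ y → ∑ᵛ k N (𝟙 ∘ topPair x y)) ≡ ∑ᵛ k N (𝟙 ∘ pair x x)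
  select x x≤N = begin
    ∑ (suc N) (λ y → ∑ᵛ k N (𝟙 ∘ topPair x y))
      ≡⟨ ∑-cong′ (suc N) (λ y → ∑ᵛ-cong k N (λ w → trans (cong 𝟙 (∧-right-comm (exactlyᵇ (x ∷ y ∷ w)) (x ≡ᵇ y) (x + (y + vsum w) ≡ᵇ t))) (𝟙-∧ (x ≡ᵇ y) _))) ⟩
    ∑ (suc N) (λ y → ∑ᵛ k N (λ w → 𝟙 (x ≡ᵇ y) * 𝟙 (pair x y w)))
      ≡⟨ ∑-cong′ (suc N) (λ y → ∑ᵛ-*ˡ k N (𝟙 (x ≡ᵇ y)) (𝟙 ∘ pair x y)) ⟩
    ∑ (suc N) (λ y → 𝟙 (x ≡ᵇ y) * ∑ᵛ k N (𝟙 ∘ pair x y))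
      ≡⟨ ∑-select (suc N) x (λ y → ∑ᵛ k N (𝟙 ∘ pair x y)) ⟩
    𝟙 (x <ᵇ suc N) * ∑ᵛ k N (𝟙 ∘ pair x x)
      ≡⟨ cong (λ b → 𝟙 b * ∑ᵛ k N (𝟙 ∘ pair x x)) (<ᵇ-suc x N) ⟩
    𝟙 (x ≤ᵇ N) * ∑ᵛ k N (𝟙 ∘ pair x x)
      ≡⟨ 𝟙≤ᵇ-*-≤ _ x≤N ⟩
    ∑ᵛ k N (𝟙 ∘ pair x x) ∎
  twin : ∀ x → x ≤ N → ∑ᵛ k N (𝟙 ∘ pair x x) ≡ 𝟙 ((1 ≤ᵇ x) ∧ (2 * x ≤ᵇ t)) * partitions 1 k x (t ∸ 2 * x)
  twin x x≤N = begin
    ∑ᵛ k N (𝟙 ∘ pair x x)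
      ≡⟨ ∑ᵛ-cong k N (λ w → trans (cong 𝟙 (reorder w)) (𝟙-∧ (x ≤ᵇ t) _)) ⟩
    ∑ᵛ k N (λ w → 𝟙 (x ≤ᵇ t) * 𝟙 (partitionᵇ 1 (x ∷ w) ∧ (x + vsum w ≡ᵇ t ∸ x)))
      ≡⟨ ∑ᵛ-*ˡ k N (𝟙 (x ≤ᵇ t)) (λ w → 𝟙 (partitionᵇ 1 (x ∷ w) ∧ (x + vsum w ≡ᵇ t ∸ x))) ⟩
    𝟙 (x ≤ᵇ t) * ∑ᵛ k N (λ w → 𝟙 (partitionᵇ 1 (x ∷ w) ∧ (x + vsum w ≡ᵇ t ∸ x)))
      ≡⟨ cong (𝟙 (x ≤ᵇ t) *_) (count-cons 1 k N x (t ∸ x) x≤N) ⟩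
    𝟙 (x ≤ᵇ t) * (𝟙 ((1 ≤ᵇ x) ∧ (x ≤ᵇ t ∸ x)) * partitions 1 k x (t ∸ x ∸ x))
      ≡⟨ 𝟙-∧-* (x ≤ᵇ t) _ _ ⟩
    𝟙 ((x ≤ᵇ t) ∧ ((1 ≤ᵇ x) ∧ (x ≤ᵇ t ∸ x))) * partitions 1 k x (t ∸ x ∸ x)
      ≡⟨ cong₂ (λ b m → 𝟙 b * partitions 1 k x m) merge (trans (∸-+-assoc t x x) (cong (t ∸_) x+x≡2x)) ⟩
    𝟙 ((1 ≤ᵇ x) ∧ (2 * x ≤ᵇ t)) * partitions 1 k x (t ∸ 2 * x) ∎
    where
    x+x≡2x : x + x ≡ 2 * x
    x+x≡2x = cong (x +_) (sym (+-identityʳ x))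
    -- The two copies of (1 ≤ᵇ x) coming from the repeated part merge by idempotence.
    reorder : ∀ w → pair x x w ≡ (x ≤ᵇ t) ∧ (partitionᵇ 1 (x ∷ w) ∧ (x + vsum w ≡ᵇ t ∸ x))
    reorder w rewrite ≤ᵇ-true (≤-refl {x}) | posᵇ≡allAtLeastᵇ-1 w | +-≡ᵇ x (x + vsum w) t =
      solve 5 (λ Nn P A E S → (Nn ⊕ (P ⊕ (P ⊕ A))) ⊕ (E ⊕ S) ⊜ E ⊕ ((Nn ⊕ (P ⊕ A)) ⊕ S)) refl
        (nonincᵇ (x ∷ w)) (1 ≤ᵇ x) (allAtLeastᵇ 1 w) (x ≤ᵇ t) (x + vsum w ≡ᵇ t ∸ x)
    merge : (x ≤ᵇ t) ∧ ((1 ≤ᵇ x) ∧ (x ≤ᵇ t ∸ x)) ≡ (1 ≤ᵇ x) ∧ (2 * x ≤ᵇ t)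
    merge = begin
      (x ≤ᵇ t) ∧ ((1 ≤ᵇ x) ∧ (x ≤ᵇ t ∸ x))
        ≡⟨ solve 3 (λ a b c → a ⊕ (b ⊕ c) ⊜ b ⊕ (a ⊕ c)) refl (x ≤ᵇ t) (1 ≤ᵇ x) (x ≤ᵇ t ∸ x) ⟩
      (1 ≤ᵇ x) ∧ ((x ≤ᵇ t) ∧ (x ≤ᵇ t ∸ x))
        ≡⟨ cong ((1 ≤ᵇ x) ∧_) (trans (≤ᵇ-∸ x x t) (cong (_≤ᵇ t) x+x≡2x)) ⟩
      (1 ≤ᵇ x) ∧ (2 * x ≤ᵇ t) ∎

-- The recurrences

⊛-cong-≤ : ∀ {f f′ g g′} n → (∀ s → s ≤ n → f s ≡ f′ s) → (∀ s → s ≤ n → g s ≡ g′ s) →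
  (f ⊛ g) n ≡ (f′ ⊛ g′) n
⊛-cong-≤ n eqf eqg = ∑-cong (suc n) (λ a a≤n → cong₂ _*_ (eqf a (s≤s⁻¹ a≤n)) (eqg (n ∸ a) (m∸n≤m n a)))

g≗atMost⊛atMost : ∀ k → g k ≗ atMost k ⊛ atMost k
g≗atMost⊛atMost k n = begin
  g k n
    ≡⟨ count-pairs k n n atMostᵇ atMostᵇ _ (λ _ _ → refl) ⟩
  (count k n atMostᵇ ⊛ count k n atMostᵇ) n
    ≡⟨ ⊛-cong-≤ n (λ _ → count-atMost k) (λ _ → count-atMost k) ⟩
  (atMost k ⊛ atMost k) n ∎

-- Generating function 1 / ((q; q)ₖ₊₁ (q²; q)ₖ), so that h (k + 1) is q^(2k+2) times it.
unshiftedH : ℕ → Series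
unshiftedH k = atMost (suc k) ⊛ twinTop k

unshiftedH-geom² : ∀ k → unshiftedH (suc k) ≗ geom (suc (suc k)) (geom (suc (suc k)) (unshiftedH k))
unshiftedH-geom² k n = begin
  (atMost (suc (suc k)) ⊛ twinTop (suc k)) n          ≡⟨ ⊛-cong (atMost-geom (suc k)) (twinTop-geom k) n ⟩
  (geom K (atMost (suc k)) ⊛ geom K (twinTop k)) n    ≡⟨ geom-⊛-geom (suc k) (atMost (suc k)) (twinTop k) n ⟩
  geom K (geom K (unshiftedH k)) n                    ∎
  where
  K = suc (suc k)

h≗shift² : ∀ k → h (suc k) ≗ shift (suc k) (shift (suc k) (unshiftedH k))
h≗shift² zero zero          = refl
h≗shift² zero (suc zero)    = refl
h≗shift² zero (suc (suc n)) = sym (cong (λ z → 1 * (1 * z)) (trans (⊛-δ (atMost 1) n) (atMost-one n)))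
h≗shift² (suc k) n = begin
  h K n
    ≡⟨ count-pairs K n n exactlyᵇ (λ b → exactlyᵇ b ∧ topTwiceᵇ b) _ reassoc ⟩
  (count K n exactlyᵇ ⊛ count K n (λ b → exactlyᵇ b ∧ topTwiceᵇ b)) n
    ≡⟨ ⊛-cong-≤ n (λ _ → count-exactly K) (λ _ → count-twinTop k) ⟩
  (shift K (atMost K) ⊛ shift K (twinTop (suc k))) n
    ≡⟨ shift-⊛-shift K K (atMost K) (twinTop (suc k)) n ⟩
  shift K (shift K (unshiftedH (suc k))) n ∎
  where
  K = suc (suc k)
  reassoc : ∀ a b → exactlyᵇ a ∧ (exactlyᵇ b ∧ (topTwiceᵇ b ∧ (vsum a + vsum b ≡ᵇ n)))
                  ≡ exactlyᵇ a ∧ ((exactlyᵇ b ∧ topTwiceᵇ b) ∧ (vsum a + vsum b ≡ᵇ n))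
  reassoc a b = cong (exactlyᵇ a ∧_) (sym (∧-assoc (exactlyᵇ b) (topTwiceᵇ b) (vsum a + vsum b ≡ᵇ n)))

geom²-∑ : ∀ k f n → geom (suc k) (geom (suc k) f) n ≡ ∑ (suc (n / suc k)) (λ i → (i + 1) * f (n ∸ suc k * i))
geom²-∑ k f n = begin
  geom K (geom K f) n
    ≡⟨ geom-geom k f n ⟩
  weightedGeom K (λ i m → suc i * f m) n
    ≡⟨ weightedGeom-∑ k (λ i m → suc i * f m) n ⟩
  ∑ (suc (n / K)) (λ i → suc i * f (n ∸ K * i))
    ≡⟨ ∑-cong′ (suc (n / K)) (λ i → cong (_* f (n ∸ K * i)) (+-comm 1 i)) ⟩
  ∑ (suc (n / K)) (λ i → (i + 1) * f (n ∸ K * i)) ∎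
  where
  K = suc k

g-recurrence : ∀ k n → g (suc k) n ≡ Σ< (suc (n / suc k)) (λ i → (i + 1) * g k (n ∸ suc k * i))
g-recurrence k n = begin
  g K n                                              ≡⟨ g≗atMost⊛atMost K n ⟩
  (atMost K ⊛ atMost K) n                            ≡⟨ ⊛-cong (atMost-geom k) (atMost-geom k) n ⟩
  (geom K (atMost k) ⊛ geom K (atMost k)) n          ≡⟨ geom-⊛-geom k (atMost k) (atMost k) n ⟩
  geom K (geom K (atMost k ⊛ atMost k)) n            ≡⟨ geom-cong K (geom-cong K (sym ∘ g≗atMost⊛atMost k)) n ⟩
  geom K (geom K (g k)) n                            ≡⟨ geom²-∑ k (g k) n ⟩
  ∑ (suc (n / K)) (λ i → (i + 1) * g k (n ∸ K * i))   ≡⟨ sym (Σ<≡∑ (suc (n / K)) _) ⟩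
  Σ< (suc (n / K)) (λ i → (i + 1) * g k (n ∸ K * i))  ∎
  where
  K = suc k

/-∸-1 : ∀ j n → suc j + suc j ≤ n → n / suc j ∸ 1 ≡ suc ((n ∸ (suc j + suc j)) / suc j)
/-∸-1 j n 2K≤n = begin
  n / K ∸ 1                ≡⟨ cong (_∸ 1) (m/n≡1+[m∸n]/n (m+n≤o⇒m≤o K 2K≤n)) ⟩
  (n ∸ K) / K              ≡⟨ m/n≡1+[m∸n]/n (m+n≤o⇒m≤o∸n K 2K≤n) ⟩
  suc ((n ∸ K ∸ K) / K)    ≡⟨ cong (λ m → suc (m / K)) (∸-+-assoc n K K) ⟩
  suc ((n ∸ (K + K)) / K)  ∎
  where
  K = suc j

/-∸-1-< : ∀ j n → n < suc j + suc j → n / suc j ∸ 1 ≡ 0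
/-∸-1-< j n n<2K = m≤n⇒m∸n≡0 (s≤s⁻¹ (m<n*o⇒m/o<n {n} {2} {suc j} n<2*K))
  where
  n<2*K : n < 2 * suc j
  n<2*K = subst (n <_) (cong (suc j +_) (sym (+-identityʳ (suc j)))) n<2K

h-from-unshifted : ∀ k n i → let K = suc (suc k) in
  K + K ≤ n → K * i ≤ n ∸ (K + K) → h (suc k) (n ∸ K * i ∸ 2) ≡ unshiftedH k (n ∸ (K + K) ∸ K * i)
h-from-unshifted k n i 2K≤n Ki≤m = begin
  h (suc k) (n ∸ K * i ∸ 2)
    ≡⟨ h≗shift² k _ ⟩
  shift (suc k) (shift (suc k) (unshiftedH k)) (n ∸ K * i ∸ 2)
    ≡⟨ shift-shift (suc k) (suc k) (unshiftedH k) (n ∸ K * i ∸ 2) ⟩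
  shift L (unshiftedH k) (n ∸ K * i ∸ 2)
    ≡⟨ cong (shift L (unshiftedH k)) (∸-+-assoc n (K * i) 2) ⟩
  shift L (unshiftedH k) (n ∸ (K * i + 2))
    ≡⟨ shift-≤ (unshiftedH k) (m+n≤o⇒m≤o∸n L L+Ki+2≤n) ⟩
  unshiftedH k (n ∸ (K * i + 2) ∸ L)
    ≡⟨ cong (unshiftedH k) (trans (∸-+-assoc n (K * i + 2) L) (cong (n ∸_) (total k (K * i)))) ⟩
  unshiftedH k (n ∸ (K + K + K * i))
    ≡⟨ cong (unshiftedH k) (sym (∸-+-assoc n (K + K) (K * i))) ⟩
  unshiftedH k (n ∸ (K + K) ∸ K * i) ∎
  where
  K = suc (suc k)
  L = suc k + suc k
  total : ∀ k Ki → Ki + 2 + (suc k + suc k) ≡ suc (suc k) + suc (suc k) + Ki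
  total = solve-∀
  L+Ki+2≤n : L + (K * i + 2) ≤ n
  L+Ki+2≤n = subst (_≤ n) (sym (trans (+-comm L (K * i + 2)) (total k (K * i))))
                    (≤-trans (+-monoʳ-≤ (K + K) Ki≤m) (≤-reflexive (m+[n∸m]≡n 2K≤n)))

h-recurrence : ∀ k n →
  h (suc (suc k)) n ≡ Σ< (n / suc (suc k) ∸ 1) (λ i → (i + 1) * h (suc k) (n ∸ suc (suc k) * i ∸ 2))
h-recurrence k n with suc (suc k) + suc (suc k) ≤? n
... | no 2K≰n = begin
  h K n                                      ≡⟨ h≗shift² (suc k) n ⟩
  shift K (shift K (unshiftedH (suc k))) n   ≡⟨ shift-shift K K (unshiftedH (suc k)) n ⟩
  shift (K + K) (unshiftedH (suc k)) n       ≡⟨ shift-> (unshiftedH (suc k)) (≰⇒> 2K≰n) ⟩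
  0                                          ≡⟨ cong (λ l → Σ< l φ) (sym (/-∸-1-< (suc k) n (≰⇒> 2K≰n))) ⟩
  Σ< (n / K ∸ 1) φ                           ∎
  where
  K = suc (suc k)
  φ : ℕ → ℕ
  φ i = (i + 1) * h (suc k) (n ∸ K * i ∸ 2)
... | yes 2K≤n = begin
  h K n                                      ≡⟨ h≗shift² (suc k) n ⟩
  shift K (shift K (unshiftedH (suc k))) n   ≡⟨ shift-shift K K (unshiftedH (suc k)) n ⟩
  shift (K + K) (unshiftedH (suc k)) n       ≡⟨ shift-≤ (unshiftedH (suc k)) 2K≤n ⟩
  unshiftedH (suc k) m                       ≡⟨ unshiftedH-geom² k m ⟩
  geom K (geom K (unshiftedH k)) m           ≡⟨ geom²-∑ (suc k) (unshiftedH k) m ⟩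
  ∑ (suc (m / K)) (λ i → (i + 1) * unshiftedH k (m ∸ K * i))
    ≡⟨ ∑-cong (suc (m / K)) (λ i i≤m/K → cong ((i + 1) *_) (sym (from-unshifted i (s≤s⁻¹ i≤m/K)))) ⟩
  ∑ (suc (m / K)) φ                          ≡⟨ sym (Σ<≡∑ (suc (m / K)) φ) ⟩
  Σ< (suc (m / K)) φ                         ≡⟨ cong (λ l → Σ< l φ) (sym (/-∸-1 (suc k) n 2K≤n)) ⟩
  Σ< (n / K ∸ 1) φ                           ∎
  where
  K = suc (suc k)
  m = n ∸ (K + K)
  φ : ℕ → ℕ
  φ i = (i + 1) * h (suc k) (n ∸ K * i ∸ 2)
  from-unshifted : ∀ i → i ≤ m / K → h (suc k) (n ∸ K * i ∸ 2) ≡ unshiftedH k (m ∸ K * i)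
  from-unshifted i i≤m/K = h-from-unshifted k n i 2K≤n (≤/⇒*≤ (suc k) {i} {m} i≤m/K)

lemma9p2 : ((k n : ℕ) →
               g (suc k) n ≡ Σ< (suc (n / suc k)) (λ i → (i + 1) * g k (n ∸ suc k * i)))
             × ((k n : ℕ) →
               h (suc (suc k)) n
                 ≡ Σ< (n / suc (suc k) ∸ 1) (λ i → (i + 1) * h (suc k) (n ∸ suc (suc k) * i ∸ 2)))
lemma9p2 = g-recurrence , h-recurrence
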